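{- For $n\ge1$ and $1\le k\le n$, $$\sum_{u\in U(n,k)}\mathrm{wt}(u)=\binom{n-1-\lfloor k/2\rfloor}{\lfloor (k-1)/2\rfloor}_{q^2}.$$
   Context: $\mathcal R(n,k)$ is the set of RG-words $w=w_1\cdots w_n$ (positive integers, $w_1=1$, $w_i\le\max(w_1,\dots,w_{i-1})+1$ for $i\ge2$, $\max_iw_i=k$). $U(n,k)$ is the set of words in $\mathcal R(n,k)$ that are weakly increasing and in which each even letter occurs exactly once (i.e. words $1^{j_1}\,2\,3^{j_2}\,4\cdots$ ending at $k$, with each $j_i\ge1$). With $m_i=\max(w_1,\dots,w_i)$, $\mathrm{wt}(w)=\prod_{i=2}^n\mathrm{wt}_i(w)$ where $\mathrm{wt}_i(w)=q^{w_i-1}$ if $m_{i-1}\ge w_i$ and $1$ otherwise. The Gaussian binomial is $\binom ab_x=\frac{[a]_x!}{[b]_x![a-b]_x!}$ with $[m]_x=1+x+\dots+x^{m-1}$, here with $x=q^2$. -}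

module Defs where

open import Level using (Level)
open import Data.Bool using (Bool; true; false; _∧_; if_then_else_)
open import Data.Nat using (ℕ; zero; suc; _∸_; _⊔_; _/_; _≤ᵇ_; _≡ᵇ_; _%_)
open import Data.List using (List; []; _∷_; map; concatMap; upTo; length; foldr)
open import Algebra.Bundles using (CommutativeSemiring)

-- Words are lists of natural numbers (letters are positive integers).

maxW : List ℕ → ℕ
maxW = foldr _⊔_ 0

rgFrom : ℕ → List ℕ → Bool
rgFrom m []       = true
rgFrom m (x ∷ xs) = (1 ≤ᵇ x) ∧ (x ≤ᵇ suc m) ∧ rgFrom (m ⊔ x) xs

isRG : List ℕ → Bool
isRG []       = false
isRG (x ∷ xs) = (x ≡ᵇ 1) ∧ rgFrom x xs

inR : ℕ → ℕ → List ℕ → Bool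
inR n k w = isRG w ∧ (length w ≡ᵇ n) ∧ (maxW w ≡ᵇ k)

weaklyIncr : List ℕ → Bool
weaklyIncr []           = true
weaklyIncr (x ∷ [])     = true
weaklyIncr (x ∷ y ∷ xs) = (x ≤ᵇ y) ∧ weaklyIncr (y ∷ xs)

isEven : ℕ → Bool
isEven x = x % 2 ≡ᵇ 0

count : ℕ → List ℕ → ℕ
count a []       = 0
count a (x ∷ xs) = if x ≡ᵇ a then suc (count a xs) else count a xs

evenOnce : List ℕ → Bool
evenOnce w = go w
  where
  go : List ℕ → Bool
  go []       = true
  go (x ∷ xs) = (if isEven x then count x w ≡ᵇ 1 else true) ∧ go xs

inU : ℕ → ℕ → List ℕ → Bool
inU n k w = inR n k w ∧ weaklyIncr w ∧ evenOnce w

wordsOver : ℕ → ℕ → List (List ℕ)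
wordsOver b zero    = [] ∷ []
wordsOver b (suc l) =
  concatMap (λ x → map (x ∷_) (wordsOver b l)) (map suc (upTo b))

module Weighted {c ℓ : Level} (R : CommutativeSemiring c ℓ) where
  open CommutativeSemiring R

  pow : Carrier → ℕ → Carrier
  pow x zero    = 1#
  pow x (suc e) = x * pow x e

  wtFrom : Carrier → ℕ → List ℕ → Carrier
  wtFrom q m []       = 1#
  wtFrom q m (x ∷ xs) =
    (if x ≤ᵇ m then pow q (x ∸ 1) else 1#) * wtFrom q (m ⊔ x) xs

  -- wt(w) = ∏_{i=2}^n wtᵢ(w)
  wt : Carrier → List ℕ → Carrier
  wt q []       = 1#
  wt q (x ∷ xs) = wtFrom q x xs

  -- Σ_{u ∈ U(n,k)} wt(u); every word of 𝓡(n,k) has letters in {1,…,n}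
  sumU : Carrier → ℕ → ℕ → Carrier
  sumU q n k =
    foldr _+_ 0# (map (λ w → if inU n k w then wt q w else 0#) (wordsOver n n))

  qint : Carrier → ℕ → Carrier
  qint x zero    = 0#
  qint x (suc m) = 1# + x * qint x m

  qfact : Carrier → ℕ → Carrier
  qfact x zero    = 1#
  qfact x (suc m) = qint x (suc m) * qfact x m

-- A word of U(n,k) has the shape 1^(1+c₀) 2 3^(1+c₁) 4 ⋯, and only repeated
-- letters carry weight: each repetition of 2i+1 weighs q^(2i) = x^i.  With
-- b = ⌊(k-1)/2⌋ and N = n - k the sum is therefore Σ x^(Σ i cᵢ) over the
-- (c₀, …, c_b) with Σ cᵢ = N, the Gaussian binomial [N + b choose b]_x.
-- Reading words letter by letter, the weighted number of admissible tails
-- starting at an odd letter obeys q-Pascal's rule, which identifies it with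
-- that Gaussian binomial; since a = N + b, the identity
-- [b]_x! [N]_x! [N + b choose b]_x = [N + b]_x! is the statement.
module Submission where

open import Defs
open import Level using (Level)
open import Data.Nat.Base as ℕ
  using (ℕ; zero; suc; _⊔_; _≡ᵇ_; _≤ᵇ_; _≤_; _<_; z≤n; s≤s; _∸_; _/_; ⌊_/2⌋; ⌈_/2⌉)
open import Data.Nat.Properties
  using ( _≟_; _≤?_; <-cmp; ≤ᵇ⇒≤; ≤-refl; ≤-trans; <-trans; <-irrefl; ≤-<-trans; <-≤-trans; <⇒≤; <⇒≢; >⇒≢
        ; <⇒≱; ≤∧≢⇒<; n≤1+n; n<1+n; 1+n≢n; m≤m⊔n; m≤n⇒m⊔n≡n; ⊔-identityʳ; ⊔-assoc; ⊔-idem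
        ; +-suc; m≤n+m; m∸n+n≡m; m+n∸n≡m; ⌊n/2⌋+⌈n/2⌉≡n)
import Data.Nat.Properties as ℕₚ
open import Data.Nat.DivMod using (m/n≡1+[m∸n]/n)
open import Data.Bool.Base using (Bool; true; false; _∧_; not; if_then_else_; T)
open import Data.Bool.Properties using (∧-zeroʳ; ∧-identityʳ; T-∧; ∧-commutativeMonoid)
open import Data.Bool.ListAction using (all)
open import Data.List.Base using (List; []; _∷_; map; concatMap; upTo; length; foldr; applyUpTo; _++_)
open import Data.List.Properties using (map-applyUpTo)
open import Data.List.Relation.Unary.All as All using (All; []; _∷_)
open import Data.List.Relation.Unary.All.Properties using (map⁺; concat⁺)
open import Data.Product.Base using (_,_; _×_; proj₁; proj₂)
open import Data.Empty using (⊥-elim)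
open import Function.Bundles using (Equivalence)
open import Relation.Nullary using (¬_; yes; no)
open import Relation.Nullary.Decidable using (dec-true; dec-false)
open import Relation.Binary.Definitions using (tri<; tri≈; tri>)
open import Relation.Binary.PropositionalEquality as ≡ using (_≡_; _≢_; ≢-sym)
open import Algebra.Bundles using (Monoid; CommutativeMonoid; Semiring; CommutativeSemiring)
open import Algebra.Properties.CommutativeSemigroup (CommutativeMonoid.commutativeSemigroup ∧-commutativeMonoid)
  using (x∙yz≈y∙xz)

≡ᵇ-refl : ∀ m → (m ≡ᵇ m) ≡ true
≡ᵇ-refl m = dec-true (m ≟ m) ≡.refl

≢⇒≡ᵇ≡false : ∀ {m n} → m ≢ n → (m ≡ᵇ n) ≡ false
≢⇒≡ᵇ≡false {m} {n} = dec-false (m ≟ n)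

≤⇒≤ᵇ≡true : ∀ {m n} → m ≤ n → (m ≤ᵇ n) ≡ true
≤⇒≤ᵇ≡true {m} {n} = dec-true (m ≤? n)

≰⇒≤ᵇ≡false : ∀ {m n} → ¬ m ≤ n → (m ≤ᵇ n) ≡ false
≰⇒≤ᵇ≡false {m} {n} = dec-false (m ≤? n)

∧-congˡ-T : ∀ a {b c} → (T a → b ≡ c) → a ∧ b ≡ a ∧ c
∧-congˡ-T true  b≡c = b≡c _
∧-congˡ-T false _   = ≡.refl

∧-pull : ∀ a b c d → a ∧ (b ∧ (c ∧ d)) ≡ c ∧ (a ∧ (b ∧ d))
∧-pull a b c d = ≡.trans (≡.cong (a ∧_) (x∙yz≈y∙xz b c d)) (x∙yz≈y∙xz a c (b ∧ d))

all-congᴬ : ∀ {p p′ : ℕ → Bool} {u} → All (λ z → p z ≡ p′ z) u → all p u ≡ all p′ u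
all-congᴬ []         = ≡.refl
all-congᴬ (eq ∷ eqs) = ≡.cong₂ _∧_ eq (all-congᴬ eqs)

isEven-suc : ∀ m → isEven m ≡ false → isEven (suc m) ≡ true
isEven-suc (suc zero)    _   = ≡.refl
isEven-suc (suc (suc m)) odd = isEven-suc m odd

odd⇒1≤ : ∀ m → isEven m ≡ false → 1 ≤ m
odd⇒1≤ (suc m) _ = s≤s z≤n

n/2≡⌊n/2⌋ : ∀ n → n / 2 ≡ ⌊ n /2⌋
n/2≡⌊n/2⌋ zero          = ≡.refl
n/2≡⌊n/2⌋ (suc zero)    = ≡.refl
n/2≡⌊n/2⌋ (suc (suc n)) = ≡.trans (m/n≡1+[m∸n]/n {suc (suc n)} (s≤s (s≤s z≤n))) (≡.cong suc (n/2≡⌊n/2⌋ n))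

m∸⌈n/2⌉≡m∸n+⌊n/2⌋ : ∀ {m n} → n ≤ m → m ∸ ⌈ n /2⌉ ≡ m ∸ n ℕ.+ ⌊ n /2⌋
m∸⌈n/2⌉≡m∸n+⌊n/2⌋ {m} {n} n≤m = begin
  m ∸ ⌈ n /2⌉                                  ≡⟨ ≡.cong (λ t → t ∸ ⌈ n /2⌉) (m∸n+n≡m n≤m) ⟨
  m ∸ n ℕ.+ n ∸ ⌈ n /2⌉                        ≡⟨ ≡.cong (λ t → m ∸ n ℕ.+ t ∸ ⌈ n /2⌉) (⌊n/2⌋+⌈n/2⌉≡n n) ⟨
  m ∸ n ℕ.+ (⌊ n /2⌋ ℕ.+ ⌈ n /2⌉) ∸ ⌈ n /2⌉     ≡⟨ ≡.cong (_∸ ⌈ n /2⌉) (ℕₚ.+-assoc (m ∸ n) ⌊ n /2⌋ ⌈ n /2⌉) ⟨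
  m ∸ n ℕ.+ ⌊ n /2⌋ ℕ.+ ⌈ n /2⌉ ∸ ⌈ n /2⌉       ≡⟨ m+n∸n≡m (m ∸ n ℕ.+ ⌊ n /2⌋) ⌈ n /2⌉ ⟩
  m ∸ n ℕ.+ ⌊ n /2⌋                            ∎
  where open ≡.≡-Reasoning

+-suc-suc : ∀ d m → d ℕ.+ suc (suc m) ≡ suc (suc (d ℕ.+ m))
+-suc-suc d m = ≡.trans (+-suc d (suc m)) (≡.cong suc (+-suc d m))

-- Even letters of weakly increasing words

onceIfEven : List ℕ → ℕ → Bool
onceIfEven w x = if isEven x then count x w ≡ᵇ 1 else true

-- `evenOnce` checks the letters with a local function of Defs that has no
-- accessible name.  The metavariable in evenOnceOn is solved by unification in
-- evenOnce-∷ to exactly that function; abstracting x ∷ xs makes the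
-- unification problem a pattern.
mutual
  evenOnceOn : List ℕ → List ℕ → Bool
  evenOnceOn = λ w u → _

  evenOnce-∷ : ∀ x xs → evenOnce (x ∷ xs) ≡ (onceIfEven (x ∷ xs) x ∧ evenOnceOn (x ∷ xs) xs)
  evenOnce-∷ x xs with x ∷ xs
  ... | w = ≡.refl

evenOnceOn≡all : ∀ w u → evenOnceOn w u ≡ all (onceIfEven w) u
evenOnceOn≡all w []      = ≡.refl
evenOnceOn≡all w (y ∷ u) = ≡.cong (onceIfEven w y ∧_) (evenOnceOn≡all w u)

evenOnce≡all : ∀ w → evenOnce w ≡ all (onceIfEven w) w
evenOnce≡all []       = ≡.refl
evenOnce≡all (x ∷ xs) =
  ≡.trans (evenOnce-∷ x xs) (≡.cong (onceIfEven (x ∷ xs) x ∧_) (evenOnceOn≡all (x ∷ xs) xs))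

evenUnrepeated : List ℕ → Bool
evenUnrepeated []           = true
evenUnrepeated (x ∷ [])     = true
evenUnrepeated (x ∷ y ∷ xs) = not (isEven x ∧ (x ≡ᵇ y)) ∧ evenUnrepeated (y ∷ xs)

evenUnrepeated-∷-≢ : ∀ x y ys → x ≢ y → evenUnrepeated (x ∷ y ∷ ys) ≡ evenUnrepeated (y ∷ ys)
evenUnrepeated-∷-≢ x y ys x≢y rewrite ≢⇒≡ᵇ≡false x≢y | ∧-zeroʳ (isEven x) = ≡.refl

weaklyIncr-∷⁻ : ∀ x y ys → T (weaklyIncr (x ∷ y ∷ ys)) → x ≤ y × T (weaklyIncr (y ∷ ys))
weaklyIncr-∷⁻ x y ys t with Equivalence.to (T-∧ {x ≤ᵇ y}) t
... | x≤ᵇy , t′ = ≤ᵇ⇒≤ x y x≤ᵇy , t′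

weaklyIncr⇒head≤ : ∀ x xs → T (weaklyIncr (x ∷ xs)) → All (x ≤_) xs
weaklyIncr⇒head≤ x []       _ = []
weaklyIncr⇒head≤ x (y ∷ ys) t with weaklyIncr-∷⁻ x y ys t
... | x≤y , t′ = x≤y ∷ All.map (≤-trans x≤y) (weaklyIncr⇒head≤ y ys t′)

count-fresh : ∀ x xs → All (x <_) xs → count x xs ≡ 0
count-fresh x []       []           = ≡.refl
count-fresh x (y ∷ ys) (x<y ∷ x<ys) rewrite ≢⇒≡ᵇ≡false (>⇒≢ x<y) = count-fresh x ys x<ys

onceIfEven-fresh : ∀ x xs → count x xs ≡ 0 → onceIfEven (x ∷ xs) x ≡ true
onceIfEven-fresh x xs c≡0 rewrite ≡ᵇ-refl x | c≡0 with isEven x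
... | true  = ≡.refl
... | false = ≡.refl

onceIfEven-∷ : ∀ x xs z → (T (isEven z) → x ≢ z) → onceIfEven (x ∷ xs) z ≡ onceIfEven xs z
onceIfEven-∷ x xs z x≢z with isEven z
... | false = ≡.refl
... | true rewrite ≢⇒≡ᵇ≡false (x≢z _) = ≡.refl

onceIfEven-odd : ∀ w z → isEven z ≡ false → onceIfEven w z ≡ true
onceIfEven-odd w z odd rewrite odd = ≡.refl

all-onceIfEven-repeat : ∀ {x y} ys → x ≡ y → all (onceIfEven (y ∷ ys)) (y ∷ ys) ≡ evenUnrepeated (y ∷ ys) →
                        all (onceIfEven (x ∷ y ∷ ys)) (x ∷ y ∷ ys) ≡ evenUnrepeated (x ∷ y ∷ ys)
all-onceIfEven-repeat {x} ys ≡.refl ih = byParity (isEven x) ≡.refl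
  where
  open ≡.≡-Reasoning
  byParity : ∀ b → isEven x ≡ b → all (onceIfEven (x ∷ x ∷ ys)) (x ∷ x ∷ ys) ≡ evenUnrepeated (x ∷ x ∷ ys)
  byParity true  even rewrite even | ≡ᵇ-refl x = ≡.refl
  byParity false odd  = begin
    all (onceIfEven (x ∷ x ∷ ys)) (x ∷ x ∷ ys)
      ≡⟨ all-congᴬ (All.universal (λ z → onceIfEven-∷ x (x ∷ ys) z (odd≢even z)) (x ∷ x ∷ ys)) ⟩
    onceIfEven (x ∷ ys) x ∧ all (onceIfEven (x ∷ ys)) (x ∷ ys)
      ≡⟨ ≡.cong₂ _∧_ (onceIfEven-odd (x ∷ ys) x odd) ih ⟩
    evenUnrepeated (x ∷ ys)
      ≡⟨ ≡.cong (λ b → not (b ∧ (x ≡ᵇ x)) ∧ evenUnrepeated (x ∷ ys)) odd ⟨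
    evenUnrepeated (x ∷ x ∷ ys) ∎
    where
    odd≢even : ∀ z → T (isEven z) → x ≢ z
    odd≢even z even ≡.refl = ≡.subst T odd even

all-onceIfEven-weaklyIncr : ∀ x xs → T (weaklyIncr (x ∷ xs)) →
                            all (onceIfEven (x ∷ xs)) (x ∷ xs) ≡ evenUnrepeated (x ∷ xs)
all-onceIfEven-weaklyIncr x []       _ = ≡.cong (_∧ true) (onceIfEven-fresh x [] ≡.refl)
all-onceIfEven-weaklyIncr x (y ∷ ys) t with <-cmp x y
... | tri< x<y _ _ = begin
  onceIfEven (x ∷ y ∷ ys) x ∧ all (onceIfEven (x ∷ y ∷ ys)) (y ∷ ys)
    ≡⟨ ≡.cong₂ _∧_ (onceIfEven-fresh x (y ∷ ys) (count-fresh x (y ∷ ys) x<y∷ys))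
                 (all-congᴬ (All.map (λ x<z → onceIfEven-∷ x (y ∷ ys) _ (λ _ → <⇒≢ x<z)) x<y∷ys)) ⟩
  all (onceIfEven (y ∷ ys)) (y ∷ ys)
    ≡⟨ all-onceIfEven-weaklyIncr y ys t′ ⟩
  evenUnrepeated (y ∷ ys)
    ≡⟨ evenUnrepeated-∷-≢ x y ys (<⇒≢ x<y) ⟨
  evenUnrepeated (x ∷ y ∷ ys) ∎
  where
  open ≡.≡-Reasoning
  t′ = proj₂ (weaklyIncr-∷⁻ x y ys t)
  x<y∷ys : All (x <_) (y ∷ ys)
  x<y∷ys = x<y ∷ All.map (<-≤-trans x<y) (weaklyIncr⇒head≤ y ys t′)
... | tri≈ _ x≡y _ = all-onceIfEven-repeat ys x≡y (all-onceIfEven-weaklyIncr y ys (proj₂ (weaklyIncr-∷⁻ x y ys t)))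
... | tri> _ _ y<x = ⊥-elim (<⇒≱ y<x (proj₁ (weaklyIncr-∷⁻ x y ys t)))

-- Admissible tails of U-words

-- isUSuffix k m w: appending w to a prefix of a U-word that ends in its maximum m
-- yields a word of U(·,k).
isUSuffix : ℕ → ℕ → List ℕ → Bool
isUSuffix k m w = (rgFrom m w ∧ (maxW (m ∷ w) ≡ᵇ k)) ∧ (weaklyIncr (m ∷ w) ∧ evenUnrepeated (m ∷ w))

inU-1∷ : ∀ l k w → length w ≡ l → inU (suc l) k (1 ∷ w) ≡ isUSuffix k 1 w
inU-1∷ l k w ≡.refl rewrite ≡ᵇ-refl (length w) =
  ≡.cong ((rgFrom 1 w ∧ (maxW (1 ∷ w) ≡ᵇ k)) ∧_) (∧-congˡ-T (weaklyIncr (1 ∷ w))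
    (λ t → ≡.trans (evenOnce≡all (1 ∷ w)) (all-onceIfEven-weaklyIncr 1 w t)))

inU-≢1∷ : ∀ n k {x} w → x ≢ 1 → inU n k (x ∷ w) ≡ false
inU-≢1∷ n k w x≢1 rewrite ≢⇒≡ᵇ≡false x≢1 = ≡.refl

module _ (k : ℕ) where

  isUSuffix-[] : ∀ m → isUSuffix k m [] ≡ (m ≡ᵇ k)
  isUSuffix-[] m rewrite ⊔-identityʳ m = ∧-identityʳ _

  isUSuffix-repeat : ∀ {m} w → 1 ≤ m → isUSuffix k m (m ∷ w) ≡ not (isEven m) ∧ isUSuffix k m w
  isUSuffix-repeat {m} w 1≤m
    rewrite ≤⇒≤ᵇ≡true 1≤m | ≤⇒≤ᵇ≡true (n≤1+n m) | ≤⇒≤ᵇ≡true (≤-refl {m}) | ≡ᵇ-refl m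
          | ≡.sym (⊔-assoc m m (maxW w)) | ⊔-idem m | ∧-identityʳ (isEven m)
    = ∧-pull (rgFrom m w ∧ (m ⊔ maxW w ≡ᵇ k)) (weaklyIncr (m ∷ w)) (not (isEven m)) (evenUnrepeated (m ∷ w))

  isUSuffix-climb : ∀ {m} w → isUSuffix k m (suc m ∷ w) ≡ isUSuffix k (suc m) w
  isUSuffix-climb {m} w
    rewrite ≤⇒≤ᵇ≡true (≤-refl {suc m}) | ≤⇒≤ᵇ≡true (n≤1+n m) | ≢⇒≡ᵇ≡false {m} (≢-sym 1+n≢n)
          | ≡.sym (⊔-assoc m (suc m) (maxW w)) | m≤n⇒m⊔n≡n (n≤1+n m) | ∧-zeroʳ (isEven m)
    = ≡.refl

  isUSuffix-reject : ∀ {m y} w → y ≢ m → y ≢ suc m → isUSuffix k m (y ∷ w) ≡ false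
  isUSuffix-reject {m} {y} w y≢m y≢1+m with <-cmp y m
  ... | tri< y<m _ _ rewrite ≰⇒≤ᵇ≡false (<⇒≱ y<m) = ∧-zeroʳ _
  ... | tri≈ _ y≡m _ = ⊥-elim (y≢m y≡m)
  ... | tri> _ _ m<y rewrite ≤⇒≤ᵇ≡true (≤-trans (s≤s z≤n) m<y)
                           | ≰⇒≤ᵇ≡false (<⇒≱ (≤∧≢⇒< m<y (≢-sym y≢1+m))) = ≡.refl

  isUSuffix-big : ∀ {m} w → k < m → isUSuffix k m w ≡ false
  isUSuffix-big {m} w k<m
    rewrite ≢⇒≡ᵇ≡false (λ max≡k → <⇒≱ k<m (≡.subst (m ≤_) max≡k (m≤m⊔n m (maxW w))))
          | ∧-zeroʳ (rgFrom m w)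
    = ≡.refl

range : ℕ → ℕ → List ℕ
range c zero    = []
range c (suc b) = c ∷ range (suc c) b

applyUpTo≡range : ∀ {f} c b → (∀ i → f i ≡ c ℕ.+ i) → applyUpTo f b ≡ range c b
applyUpTo≡range c zero    f≗c+ = ≡.refl
applyUpTo≡range c (suc b) f≗c+ =
  ≡.cong₂ _∷_ (≡.trans (f≗c+ 0) (ℕₚ.+-identityʳ c))
              (applyUpTo≡range (suc c) b (λ i → ≡.trans (f≗c+ (suc i)) (+-suc c i)))

letters≡range : ∀ b → map suc (upTo b) ≡ range 1 b
letters≡range b = ≡.trans (map-applyUpTo (λ i → i) suc b) (applyUpTo≡range 1 b (λ i → ≡.refl))

wordsOver-length : ∀ b l → All (λ w → length w ≡ l) (wordsOver b l)
wordsOver-length b zero    = ≡.refl ∷ []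
wordsOver-length b (suc l) =
  concat⁺ (map⁺ (All.universal (λ x → map⁺ (All.map (≡.cong suc) (wordsOver-length b l))) (map suc (upTo b))))

module ListSum {c ℓ : Level} (M : Monoid c ℓ) where
  open Monoid M
  open import Relation.Binary.Reasoning.Setoid setoid

  ∑ : {A : Set} → List A → (A → Carrier) → Carrier
  ∑ xs f = foldr _∙_ ε (map f xs)

  syntax ∑ xs (λ x → e) = ∑[ x ∈ xs ] e

  ∑-cong-All : ∀ {A : Set} {f g : A → Carrier} {xs} → All (λ x → f x ≈ g x) xs → ∑ xs f ≈ ∑ xs g
  ∑-cong-All []           = refl
  ∑-cong-All (fx≈gx ∷ eqs) = ∙-cong fx≈gx (∑-cong-All eqs)

  ∑-cong : ∀ {A : Set} {f g : A → Carrier} → (∀ x → f x ≈ g x) → ∀ xs → ∑ xs f ≈ ∑ xs g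
  ∑-cong f≈g xs = ∑-cong-All (All.universal f≈g xs)

  ∑-zero : ∀ {A : Set} {f : A → Carrier} → (∀ x → f x ≈ ε) → ∀ xs → ∑ xs f ≈ ε
  ∑-zero f≈0 []       = refl
  ∑-zero f≈0 (x ∷ xs) = trans (∙-cong (f≈0 x) (∑-zero f≈0 xs)) (identityˡ ε)

  ∑-++ : ∀ {A : Set} (xs ys : List A) (f : A → Carrier) → ∑ (xs ++ ys) f ≈ ∑ xs f ∙ ∑ ys f
  ∑-++ []       ys f = sym (identityˡ _)
  ∑-++ (x ∷ xs) ys f = trans (∙-congˡ (∑-++ xs ys f)) (sym (assoc _ _ _))

  ∑-concatMap : ∀ {A B : Set} (g : A → List B) (xs : List A) (f : B → Carrier) →
                ∑ (concatMap g xs) f ≈ ∑[ x ∈ xs ] ∑ (g x) f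
  ∑-concatMap g []       f = refl
  ∑-concatMap g (x ∷ xs) f = trans (∑-++ (g x) (concatMap g xs) f) (∙-congˡ (∑-concatMap g xs f))

  ∑-map : ∀ {A B : Set} (g : A → B) (xs : List A) (f : B → Carrier) → ∑ (map g xs) f ≈ ∑[ x ∈ xs ] f (g x)
  ∑-map g []       f = refl
  ∑-map g (x ∷ xs) f = ∙-congˡ (∑-map g xs f)

  ∑-wordsOver-suc : ∀ b l (f : List ℕ → Carrier) →
                    ∑ (wordsOver b (suc l)) f ≈ ∑[ x ∈ range 1 b ] ∑[ w ∈ wordsOver b l ] f (x ∷ w)
  ∑-wordsOver-suc b l f = begin
    ∑ (wordsOver b (suc l)) f
      ≈⟨ ∑-concatMap (λ x → map (x ∷_) (wordsOver b l)) (map suc (upTo b)) f ⟩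
    ∑[ x ∈ map suc (upTo b) ] ∑ (map (x ∷_) (wordsOver b l)) f
      ≈⟨ ∑-cong (λ x → ∑-map (x ∷_) (wordsOver b l) f) (map suc (upTo b)) ⟩
    ∑[ x ∈ map suc (upTo b) ] ∑[ w ∈ wordsOver b l ] f (x ∷ w)
      ≡⟨ ≡.cong (λ xs → ∑[ x ∈ xs ] ∑[ w ∈ wordsOver b l ] f (x ∷ w)) (letters≡range b) ⟩
    ∑[ x ∈ range 1 b ] ∑[ w ∈ wordsOver b l ] f (x ∷ w) ∎

  ∑-range-zero : ∀ {φ : ℕ → Carrier} c b → (∀ x → c ≤ x → φ x ≈ ε) → ∑ (range c b) φ ≈ ε
  ∑-range-zero c zero    φ≈0 = refl
  ∑-range-zero c (suc b) φ≈0 =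
    trans (∙-cong (φ≈0 c ≤-refl) (∑-range-zero (suc c) b (λ x c<x → φ≈0 x (<⇒≤ c<x)))) (identityˡ ε)

  ∑-range-single : ∀ {φ : ℕ → Carrier} c b {m} → c ≤ m → m < c ℕ.+ b →
                   (∀ x → c ≤ x → x ≢ m → φ x ≈ ε) → ∑ (range c b) φ ≈ φ m
  ∑-range-single c zero    c≤m m<c+0 _ =
    ⊥-elim (<-irrefl ≡.refl (≤-<-trans c≤m (≡.subst (_ <_) (ℕₚ.+-identityʳ c) m<c+0)))
  ∑-range-single c (suc b) {m} c≤m m<c+b φ≈0 with c ≟ m
  ... | yes ≡.refl =
    trans (∙-congˡ (∑-range-zero (suc c) b (λ x c<x → φ≈0 x (<⇒≤ c<x) (>⇒≢ c<x)))) (identityʳ _)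
  ... | no c≢m =
    trans (∙-cong (φ≈0 c ≤-refl c≢m)
                  (∑-range-single (suc c) b (≤∧≢⇒< c≤m c≢m) (≡.subst (m <_) (+-suc c b) m<c+b)
                                  (λ x c<x → φ≈0 x (<⇒≤ c<x))))
          (identityˡ _)

  ∑-range-pair : ∀ {φ : ℕ → Carrier} c b {m} → c ≤ m → suc m < c ℕ.+ b →
                 (∀ x → c ≤ x → x ≢ m → x ≢ suc m → φ x ≈ ε) → ∑ (range c b) φ ≈ φ m ∙ φ (suc m)
  ∑-range-pair c zero    c≤m m<c+0 _ =
    ⊥-elim (<-irrefl ≡.refl (≤-<-trans c≤m (<-trans (n<1+n _) (≡.subst (_ <_) (ℕₚ.+-identityʳ c) m<c+0))))
  ∑-range-pair c (suc b) {m} c≤m 1+m<c+b φ≈0 with c ≟ m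
  ... | yes ≡.refl =
    ∙-congˡ (∑-range-single (suc c) b ≤-refl (≡.subst (suc c <_) (+-suc c b) 1+m<c+b)
                            (λ x c<x → φ≈0 x (<⇒≤ c<x) (>⇒≢ c<x)))
  ... | no c≢m =
    trans (∙-cong (φ≈0 c ≤-refl c≢m (<⇒≢ (s≤s c≤m)))
                  (∑-range-pair (suc c) b (≤∧≢⇒< c≤m c≢m) (≡.subst (suc m <_) (+-suc c b) 1+m<c+b)
                                (λ x c<x → φ≈0 x (<⇒≤ c<x))))
          (identityˡ _)

module SemiringSum {c ℓ : Level} (R : Semiring c ℓ) where
  open Semiring R
  open ListSum +-monoid public

  ∑-*ˡ : ∀ {A : Set} a (xs : List A) (f : A → Carrier) → ∑[ y ∈ xs ] (a * f y) ≈ a * ∑ xs f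
  ∑-*ˡ a []       f = sym (zeroʳ a)
  ∑-*ˡ a (y ∷ xs) f = trans (+-congˡ (∑-*ˡ a xs f)) (sym (distribˡ a _ _))

-- Gaussian binomials

module GaussianBinomial {c ℓ : Level} (R : CommutativeSemiring c ℓ) where
  open CommutativeSemiring R
  open Weighted R
  open import Relation.Binary.Reasoning.Setoid setoid
  open import Algebra.Solver.Ring.NaturalCoefficients.Default R

  pow-zeroˡ : ∀ N → pow 1# N ≈ 1#
  pow-zeroˡ zero    = refl
  pow-zeroˡ (suc N) = trans (*-identityˡ _) (pow-zeroˡ N)

  pow-distrib-* : ∀ a b N → pow (a * b) N ≈ pow a N * pow b N
  pow-distrib-* a b zero    = sym (*-identityˡ 1#)
  pow-distrib-* a b (suc N) = trans (*-congˡ (pow-distrib-* a b N))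
    (solve 4 (λ a b aᴺ bᴺ → (a :* b) :* (aᴺ :* bᴺ) := (a :* aᴺ) :* (b :* bᴺ)) refl a b (pow a N) (pow b N))

  pow-cong : ∀ {a b} N → a ≈ b → pow a N ≈ pow b N
  pow-cong zero    a≈b = refl
  pow-cong (suc N) a≈b = *-cong a≈b (pow-cong N a≈b)

  module _ (x : Carrier) where

    qint-+ : ∀ a b → qint x (a ℕ.+ b) ≈ qint x a + pow x a * qint x b
    qint-+ zero    b = sym (trans (+-identityˡ _) (*-identityˡ _))
    qint-+ (suc a) b = trans (+-congˡ (*-congˡ (qint-+ a b)))
      (solve 4 (λ x [a] xᵃ [b] → con 1 :+ x :* ([a] :+ xᵃ :* [b]) := (con 1 :+ x :* [a]) :+ (x :* xᵃ) :* [b])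
             refl x (qint x a) (pow x a) (qint x b))

    -- qbinomial N r is the Gaussian binomial [N + r choose r]_x, built by q-Pascal.
    qbinomial : ℕ → ℕ → Carrier
    qbinomial zero    r       = 1#
    qbinomial (suc N) zero    = 1#
    qbinomial (suc N) (suc r) = qbinomial N (suc r) + pow x (suc N) * qbinomial (suc N) r

    qbinomial-zeroʳ : ∀ N → qbinomial N 0 ≡ 1#
    qbinomial-zeroʳ zero    = ≡.refl
    qbinomial-zeroʳ (suc N) = ≡.refl

    qfact-qbinomial : ∀ N r → (qfact x r * qfact x N) * qbinomial N r ≈ qfact x (N ℕ.+ r)
    qfact-qbinomial zero    r       = trans (*-identityʳ _) (*-identityʳ _)
    qfact-qbinomial (suc N) zero    = begin
      (1# * qfact x (suc N)) * 1# ≈⟨ trans (*-identityʳ _) (*-identityˡ _) ⟩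
      qfact x (suc N)             ≡⟨ ≡.cong (qfact x) (ℕₚ.+-identityʳ (suc N)) ⟨
      qfact x (suc N ℕ.+ 0)         ∎
    qfact-qbinomial (suc N) (suc r) = begin
      (qfact x (suc r) * qfact x (suc N)) * (qbinomial N (suc r) + pow x (suc N) * qbinomial (suc N) r)
        ≈⟨ solve 7 (λ [r+1] r! [N+1] N! B₁ xᴺ⁺¹ B₂ →
                 (([r+1] :* r!) :* ([N+1] :* N!)) :* (B₁ :+ xᴺ⁺¹ :* B₂)
              := [N+1] :* ((([r+1] :* r!) :* N!) :* B₁) :+ (xᴺ⁺¹ :* [r+1]) :* ((r! :* ([N+1] :* N!)) :* B₂))
              refl (qint x (suc r)) (qfact x r) (qint x (suc N)) (qfact x N)
                   (qbinomial N (suc r)) (pow x (suc N)) (qbinomial (suc N) r) ⟩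
      qint x (suc N) * ((qfact x (suc r) * qfact x N) * qbinomial N (suc r))
        + (pow x (suc N) * qint x (suc r)) * ((qfact x r * qfact x (suc N)) * qbinomial (suc N) r)
        ≈⟨ +-cong (*-congˡ (qfact-qbinomial N (suc r))) (*-congˡ (qfact-qbinomial (suc N) r)) ⟩
      qint x (suc N) * qfact x (N ℕ.+ suc r) + (pow x (suc N) * qint x (suc r)) * qfact x (suc N ℕ.+ r)
        ≡⟨ ≡.cong (λ t → qint x (suc N) * qfact x (N ℕ.+ suc r) + (pow x (suc N) * qint x (suc r)) * qfact x t)
                  (+-suc N r) ⟨
      qint x (suc N) * qfact x (N ℕ.+ suc r) + (pow x (suc N) * qint x (suc r)) * qfact x (N ℕ.+ suc r)
        ≈⟨ distribʳ _ _ _ ⟨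
      (qint x (suc N) + pow x (suc N) * qint x (suc r)) * qfact x (N ℕ.+ suc r)
        ≈⟨ *-congʳ (qint-+ (suc N) (suc r)) ⟨
      qfact x (suc N ℕ.+ suc r) ∎

-- Weighted sums of admissible tails

module SuffixSums {c ℓ : Level} (R : CommutativeSemiring c ℓ) (q : CommutativeSemiring.Carrier R)
                  (n k : ℕ) (k≤n : k ≤ n) where
  open CommutativeSemiring R
  open Weighted R
  open SemiringSum semiring
  open GaussianBinomial R
  open import Algebra.Solver.Ring.NaturalCoefficients.Default R
  open import Relation.Binary.Reasoning.Setoid setoid

  suffixWeight : ℕ → List ℕ → Carrier
  suffixWeight m w = if isUSuffix k m w then wtFrom q m w else 0#

  suffixSum : ℕ → ℕ → Carrier
  suffixSum m l = ∑[ w ∈ wordsOver n l ] suffixWeight m w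

  repeatWeight : ℕ → Carrier
  repeatWeight m = if isEven m then 0# else pow q (m ∸ 1)

  repeatWeight-odd : ∀ m → isEven m ≡ false → repeatWeight m ≡ pow q (m ∸ 1)
  repeatWeight-odd m odd rewrite odd = ≡.refl

  repeatWeight-even : ∀ m → isEven m ≡ true → repeatWeight m ≡ 0#
  repeatWeight-even m even rewrite even = ≡.refl

  suffixWeight-repeat : ∀ {m} w → 1 ≤ m → suffixWeight m (m ∷ w) ≈ repeatWeight m * suffixWeight m w
  suffixWeight-repeat {m} w 1≤m
    rewrite isUSuffix-repeat k w 1≤m | ≤⇒≤ᵇ≡true (≤-refl {m}) | ⊔-idem m with isEven m
  ... | true = sym (zeroˡ _)
  ... | false with isUSuffix k m w
  ...   | true  = refl
  ...   | false = sym (zeroʳ _)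

  suffixWeight-climb : ∀ {m} w → suffixWeight m (suc m ∷ w) ≈ suffixWeight (suc m) w
  suffixWeight-climb {m} w
    rewrite isUSuffix-climb k {m} w | ≰⇒≤ᵇ≡false (<-irrefl {suc m} ≡.refl) | m≤n⇒m⊔n≡n (n≤1+n m)
    with isUSuffix k (suc m) w
  ... | true  = *-identityˡ _
  ... | false = refl

  suffixWeight-reject : ∀ {m y} w → y ≢ m → y ≢ suc m → suffixWeight m (y ∷ w) ≈ 0#
  suffixWeight-reject w y≢m y≢1+m rewrite isUSuffix-reject k w y≢m y≢1+m = refl

  suffixWeight-big : ∀ {m} w → k < m → suffixWeight m w ≈ 0#
  suffixWeight-big w k<m rewrite isUSuffix-big k w k<m = refl

  suffixSum-[]-top : suffixSum k 0 ≈ 1#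
  suffixSum-[]-top rewrite isUSuffix-[] k k | ≡ᵇ-refl k = +-identityʳ 1#

  suffixSum-[] : ∀ {m} → m ≢ k → suffixSum m 0 ≈ 0#
  suffixSum-[] {m} m≢k rewrite isUSuffix-[] k m | ≢⇒≡ᵇ≡false m≢k = +-identityʳ 0#

  private
    ∑-repeat : ∀ {m} l → 1 ≤ m → ∑[ w ∈ wordsOver n l ] suffixWeight m (m ∷ w) ≈ repeatWeight m * suffixSum m l
    ∑-repeat {m} l 1≤m =
      trans (∑-cong (λ w → suffixWeight-repeat w 1≤m) (wordsOver n l))
            (∑-*ˡ (repeatWeight m) (wordsOver n l) (suffixWeight m))

  suffixSum-step : ∀ {m} l → 1 ≤ m → m < k →
                   suffixSum m (suc l) ≈ repeatWeight m * suffixSum m l + suffixSum (suc m) l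
  suffixSum-step {m} l 1≤m m<k = begin
    suffixSum m (suc l)
      ≈⟨ ∑-wordsOver-suc n l (suffixWeight m) ⟩
    ∑[ y ∈ range 1 n ] ∑[ w ∈ wordsOver n l ] suffixWeight m (y ∷ w)
      ≈⟨ ∑-range-pair 1 n 1≤m (s≤s (≤-trans m<k k≤n))
           (λ y _ y≢m y≢1+m → ∑-zero (λ w → suffixWeight-reject w y≢m y≢1+m) (wordsOver n l)) ⟩
    ∑[ w ∈ wordsOver n l ] suffixWeight m (m ∷ w) + ∑[ w ∈ wordsOver n l ] suffixWeight m (suc m ∷ w)
      ≈⟨ +-cong (∑-repeat l 1≤m) (∑-cong suffixWeight-climb (wordsOver n l)) ⟩
    repeatWeight m * suffixSum m l + suffixSum (suc m) l ∎

  suffixSum-top : ∀ l → 1 ≤ k → suffixSum k (suc l) ≈ repeatWeight k * suffixSum k l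
  suffixSum-top l 1≤k = begin
    suffixSum k (suc l)
      ≈⟨ ∑-wordsOver-suc n l (suffixWeight k) ⟩
    ∑[ y ∈ range 1 n ] ∑[ w ∈ wordsOver n l ] suffixWeight k (y ∷ w)
      ≈⟨ ∑-range-single 1 n 1≤k (s≤s k≤n) (λ y _ y≢k → ∑-zero (offTop y y≢k) (wordsOver n l)) ⟩
    ∑[ w ∈ wordsOver n l ] suffixWeight k (k ∷ w)
      ≈⟨ ∑-repeat l 1≤k ⟩
    repeatWeight k * suffixSum k l ∎
    where
    offTop : ∀ y → y ≢ k → ∀ w → suffixWeight k (y ∷ w) ≈ 0#
    offTop y y≢k w with y ≟ suc k
    ... | yes ≡.refl = trans (suffixWeight-climb w) (suffixWeight-big w (n<1+n k))
    ... | no y≢1+k   = suffixWeight-reject w y≢k y≢1+k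

  suffixSum-short : ∀ m l → 1 ≤ m → l ℕ.+ m < k → suffixSum m l ≈ 0#
  suffixSum-short m zero    1≤m m<k   = suffixSum-[] (<⇒≢ m<k)
  suffixSum-short m (suc l) 1≤m l+m<k = begin
    suffixSum m (suc l)
      ≈⟨ suffixSum-step l 1≤m (≤-<-trans (m≤n+m m (suc l)) l+m<k) ⟩
    repeatWeight m * suffixSum m l + suffixSum (suc m) l
      ≈⟨ +-cong (*-congˡ (suffixSum-short m l 1≤m (<-trans (n<1+n _) l+m<k)))
                (suffixSum-short (suc m) l (s≤s z≤n) (≡.subst (_< k) (≡.sym (+-suc l m)) l+m<k)) ⟩
    repeatWeight m * 0# + 0#
      ≈⟨ trans (+-identityʳ _) (zeroʳ _) ⟩
    0# ∎

  suffixSum-top-odd : isEven k ≡ false → ∀ N → suffixSum k N ≈ pow (pow q (k ∸ 1)) N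
  suffixSum-top-odd odd zero    = suffixSum-[]-top
  suffixSum-top-odd odd (suc N) =
    trans (suffixSum-top N (odd⇒1≤ k odd)) (*-cong (reflexive (repeatWeight-odd k odd)) (suffixSum-top-odd odd N))

  suffixSum-top-even : isEven k ≡ true → 1 ≤ k → ∀ l → suffixSum k (suc l) ≈ 0#
  suffixSum-top-even even 1≤k l =
    trans (suffixSum-top l 1≤k) (trans (*-congʳ (reflexive (repeatWeight-even k even))) (zeroˡ _))

  suffixSum-below-even-top : ∀ {m} → suc m ≡ k → isEven m ≡ false → ∀ N → suffixSum m (suc N) ≈ pow (pow q (m ∸ 1)) N
  suffixSum-below-even-top {m} ≡.refl odd zero = begin
    suffixSum m 1                                   ≈⟨ suffixSum-step 0 (odd⇒1≤ m odd) (n<1+n m) ⟩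
    repeatWeight m * suffixSum m 0 + suffixSum k 0  ≈⟨ +-cong (trans (*-congˡ (suffixSum-[] (<⇒≢ (n<1+n m)))) (zeroʳ _))
                                                              suffixSum-[]-top ⟩
    0# + 1#                                         ≈⟨ +-identityˡ 1# ⟩
    1#                                              ∎
  suffixSum-below-even-top {m} ≡.refl odd (suc N) = begin
    suffixSum m (suc (suc N))
      ≈⟨ suffixSum-step (suc N) (odd⇒1≤ m odd) (n<1+n m) ⟩
    repeatWeight m * suffixSum m (suc N) + suffixSum k (suc N)
      ≈⟨ +-cong (*-cong (reflexive (repeatWeight-odd m odd)) (suffixSum-below-even-top ≡.refl odd N))
                (suffixSum-top-even (isEven-suc m odd) (s≤s z≤n) N) ⟩
    pow q (m ∸ 1) * pow (pow q (m ∸ 1)) N + 0#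
      ≈⟨ +-identityʳ _ ⟩
    pow (pow q (m ∸ 1)) (suc N) ∎

  x : Carrier
  x = q * q

  1+m<k : ∀ d {m} → suc (suc (d ℕ.+ m)) ≡ k → suc m < k
  1+m<k d {m} 2+d+m≡k = ≡.subst (suc m <_) 2+d+m≡k (s≤s (s≤s (m≤n+m m d)))

  suffixSum-odd-step : ∀ m l → isEven m ≡ false → suc m < k →
                       suffixSum m (suc (suc l)) ≈ pow q (m ∸ 1) * suffixSum m (suc l) + suffixSum (suc (suc m)) l
  suffixSum-odd-step m l odd 1+m<k = begin
    suffixSum m (suc (suc l))
      ≈⟨ suffixSum-step (suc l) (odd⇒1≤ m odd) (<-trans (n<1+n m) 1+m<k) ⟩
    repeatWeight m * suffixSum m (suc l) + suffixSum (suc m) (suc l)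
      ≈⟨ +-cong (*-congʳ (reflexive (repeatWeight-odd m odd))) (suffixSum-step l (s≤s z≤n) 1+m<k) ⟩
    pow q (m ∸ 1) * suffixSum m (suc l) + (repeatWeight (suc m) * suffixSum (suc m) l + suffixSum (suc (suc m)) l)
      ≈⟨ +-congˡ (trans (+-congʳ (trans (*-congʳ (reflexive (repeatWeight-even (suc m) (isEven-suc m odd)))) (zeroˡ _)))
                        (+-identityˡ _)) ⟩
    pow q (m ∸ 1) * suffixSum m (suc l) + suffixSum (suc (suc m)) l ∎

  suffixSum-odd : ∀ d {m} N → isEven m ≡ false → d ℕ.+ m ≡ k →
                  suffixSum m (d ℕ.+ N) ≈ pow (pow q (m ∸ 1)) N * qbinomial x N ⌊ d /2⌋
  suffixSum-odd zero N odd ≡.refl =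
    trans (suffixSum-top-odd odd N) (sym (trans (*-congˡ (reflexive (qbinomial-zeroʳ x N))) (*-identityʳ _)))
  suffixSum-odd (suc zero) N odd 1+m≡k =
    trans (suffixSum-below-even-top 1+m≡k odd N) (sym (trans (*-congˡ (reflexive (qbinomial-zeroʳ x N))) (*-identityʳ _)))
  suffixSum-odd (suc (suc d)) {m} zero odd 2+d+m≡k rewrite ℕₚ.+-identityʳ d = begin
    suffixSum m (suc (suc d))
      ≈⟨ suffixSum-odd-step m d odd (1+m<k d 2+d+m≡k) ⟩
    pow q (m ∸ 1) * suffixSum m (suc d) + suffixSum (suc (suc m)) d
      ≈⟨ +-cong (trans (*-congˡ (suffixSum-short m (suc d) (odd⇒1≤ m odd) (≡.subst (suc d ℕ.+ m <_) 2+d+m≡k ≤-refl))) (zeroʳ _))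
                (trans (reflexive (≡.cong (suffixSum (suc (suc m))) (≡.sym (ℕₚ.+-identityʳ d))))
                       (suffixSum-odd d 0 odd (≡.trans (+-suc-suc d m) 2+d+m≡k))) ⟩
    0# + 1# * 1#
      ≈⟨ +-identityˡ _ ⟩
    1# * 1# ∎
  suffixSum-odd (suc (suc d)) {suc m} (suc N) odd 2+d+m≡k = begin
    suffixSum (suc m) (suc (suc (d ℕ.+ suc N)))
      ≈⟨ suffixSum-odd-step (suc m) (d ℕ.+ suc N) odd (1+m<k d 2+d+m≡k) ⟩
    W * suffixSum (suc m) (suc (d ℕ.+ suc N)) + suffixSum (suc (suc (suc m))) (d ℕ.+ suc N)
      ≡⟨ ≡.cong (λ l → W * suffixSum (suc m) (suc l) + suffixSum (suc (suc (suc m))) (d ℕ.+ suc N)) (+-suc d N) ⟩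
    W * suffixSum (suc m) (suc (suc d) ℕ.+ N) + suffixSum (suc (suc (suc m))) (d ℕ.+ suc N)
      ≈⟨ +-cong (*-congˡ (suffixSum-odd (suc (suc d)) N odd 2+d+m≡k))
                (suffixSum-odd d (suc N) odd (≡.trans (+-suc-suc d (suc m)) 2+d+m≡k)) ⟩
    W * (pow W N * B₁) + pow (q * (q * W)) (suc N) * B₂
      ≈⟨ +-congˡ (*-congʳ (trans (pow-cong (suc N) (sym (*-assoc q q W))) (pow-distrib-* x W (suc N)))) ⟩
    W * (pow W N * B₁) + (pow x (suc N) * (W * pow W N)) * B₂
      ≈⟨ solve 5 (λ W Wᴺ B₁ xᴺ⁺¹ B₂ → W :* (Wᴺ :* B₁) :+ (xᴺ⁺¹ :* (W :* Wᴺ)) :* B₂ := (W :* Wᴺ) :* (B₁ :+ xᴺ⁺¹ :* B₂))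
               refl W (pow W N) B₁ (pow x (suc N)) B₂ ⟩
    pow W (suc N) * qbinomial x (suc N) (suc ⌊ d /2⌋) ∎
    where
    W  = pow q m
    B₁ = qbinomial x N (suc ⌊ d /2⌋)
    B₂ = qbinomial x (suc N) ⌊ d /2⌋

module _ {c ℓ : Level} (R : CommutativeSemiring c ℓ) (q : CommutativeSemiring.Carrier R)
         (n k : ℕ) (k≤1+n : k ≤ suc n) where
  open CommutativeSemiring R
  open Weighted R
  open SemiringSum semiring
  open SuffixSums R q (suc n) k k≤1+n
  open import Relation.Binary.Reasoning.Setoid setoid

  sumU≈suffixSum : sumU q (suc n) k ≈ suffixSum 1 n
  sumU≈suffixSum = begin
    sumU q (suc n) k
      ≈⟨ ∑-wordsOver-suc (suc n) n uWeight ⟩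
    ∑[ y ∈ range 1 (suc n) ] ∑[ w ∈ wordsOver (suc n) n ] uWeight (y ∷ w)
      ≈⟨ ∑-range-single 1 (suc n) ≤-refl (s≤s (s≤s z≤n))
           (λ y _ y≢1 → ∑-zero (λ w → reflexive (≡.cong (if_then wt q (y ∷ w) else 0#) (inU-≢1∷ (suc n) k w y≢1)))
                               (wordsOver (suc n) n)) ⟩
    ∑[ w ∈ wordsOver (suc n) n ] uWeight (1 ∷ w)
      ≈⟨ ∑-cong-All (All.map (λ {w} len → reflexive (≡.cong (if_then wtFrom q 1 w else 0#) (inU-1∷ n k w len)))
                             (wordsOver-length (suc n) n)) ⟩
    suffixSum 1 n ∎
    where
    uWeight : List ℕ → Carrier
    uWeight w = if inU (suc n) k w then wt q w else 0#

sumU≈qbinomial : ∀ {c ℓ} (R : CommutativeSemiring c ℓ) q n k → k ≤ n →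
                 let open CommutativeSemiring R; open GaussianBinomial R
                 in Weighted.sumU R q (suc n) (suc k) ≈ qbinomial (q * q) (n ∸ k) ⌊ k /2⌋
sumU≈qbinomial R q n k k≤n = begin
  sumU q (suc n) (suc k)                                 ≈⟨ sumU≈suffixSum R q n (suc k) (s≤s k≤n) ⟩
  suffixSum 1 n                                          ≡⟨ ≡.cong (suffixSum 1) (ℕₚ.m+[n∸m]≡n k≤n) ⟨
  suffixSum 1 (k ℕ.+ (n ∸ k))                            ≈⟨ suffixSum-odd k (n ∸ k) ≡.refl (ℕₚ.+-comm k 1) ⟩
  pow 1# (n ∸ k) * qbinomial (q * q) (n ∸ k) ⌊ k /2⌋     ≈⟨ trans (*-congʳ (pow-zeroˡ (n ∸ k))) (*-identityˡ _) ⟩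
  qbinomial (q * q) (n ∸ k) ⌊ k /2⌋                      ∎
  where
  open CommutativeSemiring R
  open Weighted R
  open GaussianBinomial R
  open SuffixSums R q (suc n) (suc k) (s≤s k≤n)
  open import Relation.Binary.Reasoning.Setoid setoid

lemma4p4 : {c ℓ : Level} (R : CommutativeSemiring c ℓ) (q : CommutativeSemiring.Carrier R)
           (n k : ℕ) → 1 ≤ n → 1 ≤ k → k ≤ n →
           let open CommutativeSemiring R
               open Weighted R
               x = q * q
               a = n ∸ 1 ∸ (k / 2)
               b = (k ∸ 1) / 2
           in (qfact x b * qfact x (a ∸ b)) * sumU q n k ≈ qfact x a
lemma4p4 R q (suc n) (suc k) _ _ (s≤s k≤n)
  rewrite n/2≡⌊n/2⌋ k | n/2≡⌊n/2⌋ (suc k) | m∸⌈n/2⌉≡m∸n+⌊n/2⌋ k≤n | m+n∸n≡m (n ∸ k) ⌊ k /2⌋ =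
  trans (*-congˡ (sumU≈qbinomial R q n k k≤n)) (qfact-qbinomial (q * q) (n ∸ k) ⌊ k /2⌋)
  where
  open CommutativeSemiring R
  open GaussianBinomial R
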